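{- Let $F(X)$ be a propositional CNF formula all of whose variables are existentially quantified (i.e. consider $\exists X[F]$ with $Y=\emptyset$). Let $C$ be a clause of $F$ that is blocked in $F$ at a variable $w\in X$ (with respect to the empty set of free variables). Then $F\setminus\{C\}$ es-implies $C$, i.e. $\exists X[F]\equiv \exists X[F\setminus\{C\}]$ (equivalently, $F$ and $F\setminus\{C\}$ are equisatisfiable).
   Context: A CNF formula is viewed as a set of clauses. For an assignment $q$ to some variables, $C_q\equiv 1$ if $q$ satisfies clause $C$, otherwise $C_q$ is $C$ with all literals falsified by $q$ removed; $H_q$ is obtained from $H$ by removing clauses satisfied by $q$ and replacing every other clause $C$ by $C_q$. Two clauses are resolvable on $w$ if they contain opposite literals of exactly one variable, namely $w$ (clauses with opposite literals of more than one variable are considered unresolvable). Given formulas $F(X,Y),G(X,Y)$, $F$ es-implies $G$ with respect to $Y$ if $\exists X[F\wedge G]\equiv\exists X[F]$, i.e. for every full assignment $y$ to $Y$, $(F\wedge G)_y$ and $F_y$ are equisatisfiable. Blocked clause: given $\exists X[F(X,Y)]$ and a clause $C\in F$, let $G$ be the set of clauses of $F$ resolvable with $C$ on a variable $w\in X$, and let $w=b$ ($b\in\{0,1\}$) satisfy $C$. Then $C$ is blocked in $F$ at $w$ with respect to $Y$ if $(F\setminus G)_{w=b}$ es-implies $G_{w=b}$ with respect to $Y$. -}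

module Defs where

open import Data.Nat using (ℕ; _≡ᵇ_)
open import Data.Bool using (Bool; true; false; not; _∧_; _∨_; if_then_else_)
open import Data.Bool.Properties using () renaming (_≟_ to _≟B_)
open import Data.Product using (Σ; _×_; _,_; ∃)
open import Data.List using (List; []; _∷_; filter; map)
open import Data.Bool.ListAction using (any; all)
open import Data.List.Membership.Propositional using (_∈_)
open import Data.List.Relation.Unary.All using (All)
open import Data.List.Relation.Unary.Any using (Any)
open import Data.Product.Properties using (≡-dec)
open import Data.List.Properties using () renaming (≡-dec to ≡-decL)
open import Data.Nat.Properties using () renaming (_≟_ to _≟ℕ_)
open import Relation.Binary.PropositionalEquality using (_≡_)
open import Relation.Nullary using (Dec; ¬_)
open import Relation.Nullary.Decidable using (⌊_⌋; ¬?)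
open import Relation.Binary using (DecidableEquality)

-- Variables are natural numbers.  A literal is a pair (v , p):
-- the positive literal v when p = true, the negative literal ¬v when p = false.
Var : Set
Var = ℕ

Literal : Set
Literal = Var × Bool

var : Literal → Var
var (v , _) = v

pol : Literal → Bool
pol (_ , p) = p

Clause : Set
Clause = List Literal

CNF : Set
CNF = List Clause

_≟L_ : DecidableEquality Literal
_≟L_ = ≡-dec _≟ℕ_ _≟B_

_≟C_ : DecidableEquality Clause
_≟C_ = ≡-decL _≟L_

Assignment : Set
Assignment = Var → Bool

litTrue : Assignment → Literal → Set
litTrue σ (v , p) = σ v ≡ p

clauseTrue : Assignment → Clause → Set
clauseTrue σ C = Any (litTrue σ) C

cnfTrue : Assignment → CNF → Set
cnfTrue σ F = All (clauseTrue σ) F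

Sat : CNF → Set
Sat F = ∃ λ (σ : Assignment) → cnfTrue σ F

_∧F_ : CNF → CNF → CNF
F ∧F G = F Data.List.++ G

-- With Y = ∅, "F es-implies G" means ∃X[F ∧ G] ≡ ∃X[F], i.e.
-- F ∧ G and F are equisatisfiable.
EsImplies∅ : CNF → CNF → Set
EsImplies∅ F G = (Sat (F ∧F G) → Sat F) × (Sat F → Sat (F ∧F G))

hasLit : Literal → Clause → Bool
hasLit l C = any (λ m → ⌊ m ≟L l ⌋) C

clashAt : Clause → Clause → Var → Bool
clashAt C D v = any (λ l → (var l ≡ᵇ v) ∧ hasLit (v , not (pol l)) D) C

-- C and D are resolvable on w: they contain opposite literals of
-- exactly one variable, namely w.
resolvableOn : Var → Clause → Clause → Bool
resolvableOn w C D =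
  clashAt C D w ∧ all (λ l → not (hasLit (var l , not (pol l)) D) ∨ (var l ≡ᵇ w)) C

restrictClause : Var → Bool → Clause → Clause
restrictClause w b C = filter (λ l → ¬? (l ≟L (w , not b))) C

restrict : Var → Bool → CNF → CNF
restrict w b H =
  map (restrictClause w b) (filter (λ D → ¬? (hasLit (w , b) D Data.Bool.≟ true)) H)

resolvents : Var → Clause → CNF → CNF
resolvents w C F = filter (λ D → resolvableOn w C D Data.Bool.≟ true) F

nonResolvents : Var → Clause → CNF → CNF
nonResolvents w C F = filter (λ D → ¬? (resolvableOn w C D Data.Bool.≟ true)) F

BlockedAt : CNF → Clause → Var → Bool → Set
BlockedAt F C w b =
  (w , b) ∈ C × EsImplies∅ (restrict w b (nonResolvents w C F)) (restrict w b (resolvents w C F))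

removeClause : Clause → CNF → CNF
removeClause C F = filter (λ D → ¬? (D ≟C C)) F

-- If σ satisfies F ∖ {C} but not C, every literal of C is false under σ. A clause
-- D that σ satisfies while falsifying D_{w=b} is then true only through the
-- literal w = ¬b, and every literal of C whose complement lies in D is on w; so D
-- clashes with C at w alone, i.e. D is one of the resolvents G. Hence σ satisfies
-- (F ∖ G)_{w=b}, blockedness gives τ satisfying (F ∖ G)_{w=b} ∧ G_{w=b}, and τ with
-- w set to b satisfies every clause of F, C included.
module Submission where

open import Defs
open import Data.Bool using (Bool; true; false; not; _∨_; T) renaming (_≟_ to _≟B_)
open import Data.Bool.ListAction using (all)
open import Data.Bool.Properties using (¬-not; not-involutive; T-≡; T-∧)
open import Data.Nat using (_≡ᵇ_; _≟_)
open import Data.Nat.Properties using (≡⇒≡ᵇ)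
open import Data.List using ([_])
open import Data.List.Membership.Propositional using (_∈_; _∉_; lose; find)
open import Data.List.Membership.DecPropositional _≟L_ using (_∈?_)
open import Data.List.Membership.Propositional.Properties using (∈-filter⁺; ∈-filter⁻; ∈-map⁺; ∈-map⁻)
open import Data.List.Relation.Unary.All using ([]; _∷_; tabulate; lookup)
open import Data.List.Relation.Unary.All.Properties using (++⁺; ++⁻ˡ; ++⁻ʳ; filter⁺; filter⁻; all⁻)
open import Data.List.Relation.Unary.Any as Any using (any?)
open import Data.List.Relation.Unary.Any.Properties using (any⁺; any⁻)
open import Data.Product using (∃; _×_; _,_; proj₁)
open import Function using (_∘_; Equivalence)
open import Relation.Nullary using (yes; no; ¬_; contradiction)
open import Relation.Nullary.Decidable using (¬?; toWitness; fromWitness)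
open import Relation.Unary using (Decidable)
open import Relation.Binary.PropositionalEquality using (_≡_; _≢_; refl; sym; trans; cong; subst)

complement : Literal → Literal
complement (v , p) = v , not p

complement-true : ∀ σ l → ¬ litTrue σ l → litTrue σ (complement l)
complement-true σ (v , p) = ¬-not

clauseTrue? : (σ : Assignment) → Decidable (clauseTrue σ)
clauseTrue? σ = any? λ (v , p) → σ v ≟B p

hasLit⇒∈ : ∀ {l} D → hasLit l D ≡ true → l ∈ D
hasLit⇒∈ D h = Any.map (sym ∘ toWitness) (any⁻ _ D (Equivalence.from T-≡ h))

∈⇒hasLit : ∀ {l D} → l ∈ D → hasLit l D ≡ true
∈⇒hasLit l∈D = Equivalence.to T-≡ (any⁺ _ (Any.map (fromWitness ∘ sym) l∈D))

resolvableOn-intro : ∀ {w b C D} → (w , b) ∈ C → (w , not b) ∈ D →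
  (∀ {l} → l ∈ C → complement l ∈ D → var l ≡ w) → resolvableOn w C D ≡ true
resolvableOn-intro {w} {b} {C} {D} wb∈C w¬b∈D clashOnlyAtW =
  Equivalence.to T-≡ (Equivalence.from T-∧ (clashAtW , noOtherClash))
  where
  clashAtW : T (clashAt C D w)
  clashAtW = any⁺ _ (Any.map (λ { refl →
    Equivalence.from T-∧ (≡⇒≡ᵇ w w refl , Equivalence.from T-≡ (∈⇒hasLit w¬b∈D)) }) wb∈C)
  noOtherClash : T (all (λ l → not (hasLit (complement l) D) ∨ (var l ≡ᵇ w)) C)
  noOtherClash = all⁻ _ (tabulate λ {l} l∈C → onlyAtW l l∈C)
    where
    onlyAtW : ∀ l → l ∈ C → T (not (hasLit (complement l) D) ∨ (var l ≡ᵇ w))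
    onlyAtW l l∈C with hasLit (complement l) D in h
    ... | false = _
    ... | true = ≡⇒≡ᵇ _ w (clashOnlyAtW l∈C (hasLit⇒∈ D h))

∈-restrictClause⁺ : ∀ {w b l D} → l ∈ D → l ≢ (w , not b) → l ∈ restrictClause w b D
∈-restrictClause⁺ {w} {b} = ∈-filter⁺ (λ l → ¬? (l ≟L (w , not b)))

∈-restrictClause⁻ : ∀ {w b l} D → l ∈ restrictClause w b D → l ∈ D × l ≢ (w , not b)
∈-restrictClause⁻ {w} {b} D = ∈-filter⁻ (λ l → ¬? (l ≟L (w , not b))) {xs = D}

∈-restrict⁺ : ∀ {w b D H} → D ∈ H → (w , b) ∉ D → restrictClause w b D ∈ restrict w b H
∈-restrict⁺ {w} {b} D∈H wb∉D =
  ∈-map⁺ _ (∈-filter⁺ (λ D → ¬? (hasLit (w , b) D ≟B true)) D∈H (wb∉D ∘ hasLit⇒∈ _))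

∈-restrict⁻ : ∀ {w b E} H → E ∈ restrict w b H →
  ∃ λ D → D ∈ H × (w , b) ∉ D × E ≡ restrictClause w b D
∈-restrict⁻ {w} {b} H E∈ with ∈-map⁻ (restrictClause w b) E∈
... | D , D∈ , refl with ∈-filter⁻ (λ D → ¬? (hasLit (w , b) D ≟B true)) {xs = H} D∈
... | D∈H , ¬hasWB = D , D∈H , ¬hasWB ∘ ∈⇒hasLit , refl

only-removed-lit-true : ∀ {σ w b l D} → ¬ clauseTrue σ (restrictClause w b D) →
  l ∈ D → litTrue σ l → l ≡ (w , not b)
only-removed-lit-true {w = w} {b} {l} ¬σD′ l∈D σl with l ≟L (w , not b)
... | yes l≡w¬b = l≡w¬b
... | no l≢w¬b = contradiction (lose (∈-restrictClause⁺ l∈D l≢w¬b) σl) ¬σD′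

resolvable-if-restriction-falsified : ∀ {σ w b C D} → (w , b) ∈ C → ¬ clauseTrue σ C →
  clauseTrue σ D → ¬ clauseTrue σ (restrictClause w b D) → resolvableOn w C D ≡ true
resolvable-if-restriction-falsified {σ} {w} {b} {C} {D} wb∈C σ⊭C σ⊨D σ⊭D′ =
  resolvableOn-intro wb∈C w¬b∈D clashOnlyAtW
  where
  only : ∀ {l} → l ∈ D → litTrue σ l → l ≡ (w , not b)
  only = only-removed-lit-true σ⊭D′
  w¬b∈D : (w , not b) ∈ D
  w¬b∈D with find σ⊨D
  ... | l , l∈D , σl = subst (_∈ D) (only l∈D σl) l∈D
  clashOnlyAtW : ∀ {l} → l ∈ C → complement l ∈ D → var l ≡ w
  clashOnlyAtW {l} l∈C l̄∈D =
    cong proj₁ (only l̄∈D (complement-true σ l (σ⊭C ∘ lose l∈C)))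

restrict-nonResolvents-true : ∀ {σ w b C F} → (w , b) ∈ C →
  cnfTrue σ (removeClause C F) → ¬ clauseTrue σ C →
  cnfTrue σ (restrict w b (nonResolvents w C F))
restrict-nonResolvents-true {σ} {w} {b} {C} {F} wb∈C σ⊨F∖C σ⊭C =
  tabulate λ {E} E∈ → restrictionTrue E∈
  where
  restrictionTrue : ∀ {E} → E ∈ restrict w b (nonResolvents w C F) → clauseTrue σ E
  restrictionTrue E∈ with ∈-restrict⁻ (nonResolvents w C F) E∈
  ... | D , D∈G∁ , wb∉D , refl
      with ∈-filter⁻ (λ D → ¬? (resolvableOn w C D ≟B true)) {xs = F} D∈G∁
  ... | D∈F , notResolvable with clauseTrue? σ (restrictClause w b D)
  ... | yes σ⊨D′ = σ⊨D′
  ... | no σ⊭D′ = contradiction (resolvable-if-restriction-falsified wb∈C σ⊭C σ⊨D σ⊭D′) notResolvable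
    where
    D≢C : D ≢ C
    D≢C refl = wb∉D wb∈C
    σ⊨D : clauseTrue σ D
    σ⊨D = lookup σ⊨F∖C (∈-filter⁺ (λ D → ¬? (D ≟C C)) D∈F D≢C)

_[_≔_] : Assignment → Var → Bool → Assignment
(τ [ w ≔ b ]) v with v ≟ w
... | yes _ = b
... | no _ = τ v

update-true : ∀ {τ w b l} → l ≢ (w , not b) → litTrue τ l → litTrue (τ [ w ≔ b ]) l
update-true {w = w} {b} {v , p} l≢w¬b τl with v ≟ w
... | yes refl = sym (trans (¬-not (l≢w¬b ∘ cong (w ,_))) (not-involutive b))
... | no _ = τl

update-satisfies : ∀ {τ w b C} → (w , b) ∈ C → clauseTrue (τ [ w ≔ b ]) C
update-satisfies {w = w} wb∈C = lose wb∈C (update-self w)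
  where
  update-self : ∀ {τ b} w → (τ [ w ≔ b ]) w ≡ b
  update-self w with w ≟ w
  ... | yes _ = refl
  ... | no w≢w = contradiction refl w≢w

restrictClause-true-update : ∀ {τ w b} D → clauseTrue τ (restrictClause w b D) →
  clauseTrue (τ [ w ≔ b ]) D
restrictClause-true-update D τ⊨D′ with find τ⊨D′
... | l , l∈D′ , τl with ∈-restrictClause⁻ D l∈D′
... | l∈D , l≢w¬b = lose l∈D (update-true l≢w¬b τl)

restrict-true-update : ∀ {τ w b} H → cnfTrue τ (restrict w b H) → cnfTrue (τ [ w ≔ b ]) H
restrict-true-update {τ} {w} {b} H τ⊨H′ = tabulate λ {D} D∈H → clauseTrue-update D∈H
  where
  clauseTrue-update : ∀ {D} → D ∈ H → clauseTrue (τ [ w ≔ b ]) D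
  clauseTrue-update {D} D∈H with (w , b) ∈? D
  ... | yes wb∈D = update-satisfies wb∈D
  ... | no wb∉D = restrictClause-true-update D (lookup τ⊨H′ (∈-restrict⁺ D∈H wb∉D))

lemma1 : (F : CNF) (C : Clause) (w : Var) (b : Bool) →
    C ∈ F → BlockedAt F C w b →
    EsImplies∅ (removeClause C F) [ C ]
lemma1 F C w b _ (wb∈C , _ , extend) = dropC , addC
  where
  dropC : Sat (removeClause C F ∧F [ C ]) → Sat (removeClause C F)
  dropC (σ , σ⊨) = σ , ++⁻ˡ (removeClause C F) σ⊨
  addC : Sat (removeClause C F) → Sat (removeClause C F ∧F [ C ])
  addC (σ , σ⊨F∖C) with clauseTrue? σ C
  ... | yes σ⊨C = σ , ++⁺ σ⊨F∖C (σ⊨C ∷ [])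
  ... | no σ⊭C with extend (σ , restrict-nonResolvents-true {F = F} wb∈C σ⊨F∖C σ⊭C)
  ... | τ , τ⊨ = τ [ w ≔ b ] , ++⁺ (filter⁺ _ τ′⊨F) (update-satisfies wb∈C ∷ [])
    where
    NR : CNF
    NR = restrict w b (nonResolvents w C F)
    τ′⊨F : cnfTrue (τ [ w ≔ b ]) F
    τ′⊨F = filter⁻ (λ D → resolvableOn w C D ≟B true)
      (restrict-true-update (resolvents w C F) (++⁻ʳ NR τ⊨))
      (restrict-true-update (nonResolvents w C F) (++⁻ˡ NR τ⊨))
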